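{- Let $L$ be a normal bimodal logic such that (1) $L$ contains $\mathbf K\times\mathbf{Diff}$, and (2) for every positive integer $k$ there are sets $U,V$ with $|V|\ge k$, $|U|\ge 2|V|$ such that $(U,U\times U)\times(V,\neq_V)$ is a frame for $L$. Then $L$ is not axiomatisable using finitely many propositional variables, i.e. there is no set $\Sigma$ of formulas containing altogether only finitely many distinct variables such that $L$ is the smallest normal bimodal logic containing $\Sigma$.
   Context: Bimodal formulas use variables, Boolean connectives and $\Box_h,\Box_v,\Diamond_h,\Diamond_v$, evaluated in frames $(W,R_h,R_v)$; a normal bimodal logic contains all tautologies and $\Box_i(p\to q)\to(\Box_ip\to\Box_iq)$ ($i=h,v$), closed under substitution, modus ponens and necessitation; a frame for $L$ is a frame validating all formulas of $L$. The product of unimodal frames $(U,R)$ and $(V,S)$ is the frame $(U\times V,\bar R_h,\bar R_v)$ with $(x,y)\bar R_h(x',y')$ iff $xRx'$ and $y=y'$, and $(x,y)\bar R_v(x',y')$ iff $ySy'$ and $x=x'$. $U\times U$ is the universal relation on $U$ and $\neq_V$ is inequality on $V$. $\mathbf K\times\mathbf{Diff}$ is the set of formulas valid in all products $(U,R)\times(V,S)$ where $(U,R)$ is an arbitrary unimodal frame and $S$ is symmetric and pseudo-transitive ($ySy'\wedge y'Sy''\to(y=y''\vee ySy'')$). -}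

module Defs where

open import Level using (Level; 0ℓ) renaming (suc to lsuc)
open import Data.Nat using (ℕ; _<_)
open import Data.Bool using (Bool; true; false; _∧_; not; _∨_)
open import Data.Empty using (⊥)
open import Data.Unit using (⊤)
open import Data.Product using (Σ; Σ-syntax; ∃; ∃-syntax; _×_; _,_)
open import Data.Sum using (_⊎_)
open import Data.Fin using (Fin)
open import Relation.Nullary using (¬_)
open import Relation.Binary.PropositionalEquality using (_≡_)
open import Function.Bundles using (_↣_)

data Mod : Set where
  h v : Mod

data Formula : Set where
  var  : ℕ → Formula
  fls  : Formula
  _⇒_  : Formula → Formula → Formula
  box  : Mod → Formula → Formula

infixr 5 _⇒_

neg : Formula → Formula
neg φ = φ ⇒ fls

dia : Mod → Formula → Formula
dia i φ = neg (box i (neg φ))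

_[_] : Formula → (ℕ → Formula) → Formula
var n   [ σ ] = σ n
fls     [ σ ] = fls
(φ ⇒ ψ) [ σ ] = (φ [ σ ]) ⇒ (ψ [ σ ])
box i φ [ σ ] = box i (φ [ σ ])

data VarsBelow (n : ℕ) : Formula → Set where
  var : ∀ {m} → m < n → VarsBelow n (var m)
  fls : VarsBelow n fls
  imp : ∀ {φ ψ} → VarsBelow n φ → VarsBelow n ψ → VarsBelow n (φ ⇒ ψ)
  box : ∀ {i φ} → VarsBelow n φ → VarsBelow n (box i φ)

beval : (Formula → Bool) → Formula → Bool
beval a (var n)   = a (var n)
beval a fls       = false
beval a (φ ⇒ ψ)   = not (beval a φ) ∨ beval a ψ
beval a (box i φ) = a (box i φ)

Tautology : Formula → Set
Tautology φ = ∀ (a : Formula → Bool) → beval a φ ≡ true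

Kax : Mod → Formula
Kax i = box i (var 0 ⇒ var 1) ⇒ (box i (var 0) ⇒ box i (var 1))

record IsNormal (L : Formula → Set₁) : Set₁ where
  field
    taut : ∀ φ → Tautology φ → L φ
    kax  : ∀ i → L (Kax i)
    sub  : ∀ φ (σ : ℕ → Formula) → L φ → L (φ [ σ ])
    mp   : ∀ φ ψ → L φ → L (φ ⇒ ψ) → L ψ
    nec  : ∀ i φ → L φ → L (box i φ)

data Deriv (Γ : Formula → Set₁) : Formula → Set₁ where
  ax   : ∀ {φ} → Γ φ → Deriv Γ φ
  taut : ∀ {φ} → Tautology φ → Deriv Γ φ
  kax  : ∀ i → Deriv Γ (Kax i)
  sub  : ∀ {φ} (σ : ℕ → Formula) → Deriv Γ φ → Deriv Γ (φ [ σ ])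
  mp   : ∀ {φ ψ} → Deriv Γ φ → Deriv Γ (φ ⇒ ψ) → Deriv Γ ψ
  nec  : ∀ {φ} i → Deriv Γ φ → Deriv Γ (box i φ)

record Frame : Set₁ where
  field
    W  : Set
    Rh : W → W → Set
    Rv : W → W → Set

rel : (F : Frame) → Mod → Frame.W F → Frame.W F → Set
rel F h = Frame.Rh F
rel F v = Frame.Rv F

-- truth of φ at world w under valuation val; atoms are double-negated
-- so that all truth values are ¬¬-stable and the semantics is classical
sat : (F : Frame) → (ℕ → Frame.W F → Set) → Frame.W F → Formula → Set
sat F val w (var n)   = ¬ ¬ val n w
sat F val w fls       = ⊥
sat F val w (φ ⇒ ψ)   = sat F val w φ → sat F val w ψ
sat F val w (box i φ) = ∀ w′ → rel F i w w′ → sat F val w′ φ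

Valid : Frame → Formula → Set₁
Valid F φ = ∀ (val : ℕ → Frame.W F → Set) (w : Frame.W F) → sat F val w φ

FrameFor : (Formula → Set₁) → Frame → Set₁
FrameFor L F = ∀ φ → L φ → Valid F φ

product : (U : Set) → (U → U → Set) → (V : Set) → (V → V → Set) → Frame
product U R V S = record
  { W  = U × V
  ; Rh = λ { (x , y) (x′ , y′) → R x x′ × (y ≡ y′) }
  ; Rv = λ { (x , y) (x′ , y′) → S y y′ × (x ≡ x′) }
  }

Symmetric : {V : Set} → (V → V → Set) → Set
Symmetric S = ∀ {y y′} → S y y′ → S y′ y

PseudoTransitive : {V : Set} → (V → V → Set) → Set
PseudoTransitive S = ∀ {y y′ y″} → S y y′ → S y′ y″ → ¬ ¬ (y ≡ y″ ⊎ S y y″)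

KxDiff : Formula → Set₁
KxDiff φ = ∀ (U : Set) (R : U → U → Set) (V : Set) (S : V → V → Set)
           → Symmetric S → PseudoTransitive S → Valid (product U R V S) φ

univ : (U : Set) → U → U → Set
univ U _ _ = ⊤

neq : (V : Set) → V → V → Set
neq V y y′ = ¬ (y ≡ y′)

FinitelyManyVars : (Formula → Set₁) → Set₁
FinitelyManyVars Γ = ∃[ n ] (∀ φ → Γ φ → VarsBelow n φ)

-- Let Γ use only the variables below n, and put N = 2ⁿ + 1, M = N + 1. The formula Φ says: if A
-- persists along h, and the reflexive v-neighbourhood of the current point contains, for each of M
-- mutually exclusive atoms Pᵢ, a point satisfying A ∧ Pᵢ, then no h-successor colours the A-points of
-- its neighbourhood with N colours Qⱼ so that equally coloured points are never v-related. When the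
-- vertical relation is symmetric and pseudo-transitive a reflexive neighbourhood is a clique, so by
-- pigeonhole Φ ∈ K × Diff ⊆ L.
--
-- Φ fails in a frame G made of an upper v-clique of M points and a lower v-clique of N points, all
-- h-related to each other, together with two copies of the rest of V. Under any valuation on G two
-- lower points are twins (agree on the variables below n), as N > 2ⁿ. Every point of U codes a layer
-- and a transposition of the M special columns of V; this sends the special columns of
-- (U, U × U) × (V, ≠) onto the upper clique bijectively, or onto the lower one identifying one column
-- with a twin, and yields an n-bisimulation onto G. So Γ, valid in the product, is valid in G, hence
-- so is everything derivable from Γ, but Φ is not.

module Submission where

open import Defs
open import Data.Bool using (Bool; true; false; if_then_else_)
open import Data.Empty using (⊥; ⊥-elim; ⊥-elim-irr)
open import Data.Fin
  using (Fin; zero; suc; toℕ; _≟_; punchIn; punchOut; fromℕ<; funToFin; finToFun; combine)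
open import Data.Fin.Properties
  using ( pigeonhole; <⇒≢; punchIn-punchOut; punchInᵢ≢i; toℕ<n; toℕ-injective
        ; finToFun-funToFin; toℕ-fromℕ<; combine-injective )
import Data.Fin.Permutation.Components as PC
open import Data.List using (List; []; _∷_; _++_)
open import Data.List.Relation.Unary.All as All using (All; []; _∷_)
open import Data.List.Relation.Unary.All.Properties using (++⁻ˡ; ++⁻ʳ)
open import Data.Nat using (ℕ; zero; suc; _+_; _*_; _^_; _<_; _≤_; s≤s; z≤n)
import Data.Nat as ℕ
open import Data.Nat.Properties using (n<1+n; m+n≮m; +-cancelˡ-≡)
open import Data.Product using (Σ; Σ-syntax; ∃; ∃-syntax; ∃₂; _×_; _,_; proj₁; proj₂)
open import Data.Sum using (_⊎_; inj₁; inj₂)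
open import Data.Unit using (⊤; tt)
open import Effect.Monad using (RawMonad)
open import Function using (_∘_; id)
open import Function.Bundles using (_⇔_; mk⇔; Equivalence; _↣_; Injection)
open import Function.Definitions using (Injective)
open import Function.Properties.Equivalence using () renaming (refl to ⇔-refl; sym to ⇔-sym)
open import Level using (0ℓ)
open import Relation.Binary.Construct.Closure.Reflexive using (ReflClosure; refl) renaming ([_] to ⟪_⟫)
open import Relation.Binary.Definitions using (DecidableEquality; Reflexive)
open import Relation.Binary.PropositionalEquality
  using (_≡_; _≢_; refl; sym; trans; cong; subst; module ≡-Reasoning)
open import Relation.Nullary using (¬_; Dec; yes; no; does; proof; Reflects; ofⁿ; invert; _→-reflects_)
open import Relation.Nullary.Decidable using (map′; _×-dec_; dec-true; ¬¬-excluded-middle)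
open import Relation.Nullary.Negation using (¬¬-Monad; ¬¬-map; negated-stable; contradiction; Stable)

open RawMonad {0ℓ} ¬¬-Monad using (_>>=_; pure)
open Equivalence using (to; from)

¬¬-∀-Fin : ∀ {k} {P : Fin k → Set} → (∀ i → ¬ ¬ P i) → ¬ ¬ (∀ i → P i)
¬¬-∀-Fin {zero}  ¬¬P = pure λ ()
¬¬-∀-Fin {suc k} ¬¬P =
  ¬¬P zero >>= λ P₀ → ¬¬-map (λ P₊ → λ { zero → P₀ ; (suc i) → P₊ i }) (¬¬-∀-Fin (¬¬P ∘ suc))

_≟ᴹ_ : DecidableEquality Mod
h ≟ᴹ h = yes refl
h ≟ᴹ v = no λ ()
v ≟ᴹ h = no λ ()
v ≟ᴹ v = yes refl

_≟ᶠ_ : DecidableEquality Formula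
var m ≟ᶠ var n = map′ (cong var) (λ { refl → refl }) (m ℕ.≟ n)
fls ≟ᶠ fls = yes refl
(φ ⇒ ψ) ≟ᶠ (φ′ ⇒ ψ′) =
  map′ (λ { (refl , refl) → refl }) (λ { refl → refl , refl }) (φ ≟ᶠ φ′ ×-dec ψ ≟ᶠ ψ′)
box i φ ≟ᶠ box j ψ =
  map′ (λ { (refl , refl) → refl }) (λ { refl → refl , refl }) (i ≟ᴹ j ×-dec φ ≟ᶠ ψ)
var _   ≟ᶠ fls     = no λ ()
var _   ≟ᶠ (_ ⇒ _) = no λ ()
var _   ≟ᶠ box _ _ = no λ ()
fls     ≟ᶠ var _   = no λ ()
fls     ≟ᶠ (_ ⇒ _) = no λ ()
fls     ≟ᶠ box _ _ = no λ ()
(_ ⇒ _) ≟ᶠ var _   = no λ ()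
(_ ⇒ _) ≟ᶠ fls     = no λ ()
(_ ⇒ _) ≟ᶠ box _ _ = no λ ()
box _ _ ≟ᶠ var _   = no λ ()
box _ _ ≟ᶠ fls     = no λ ()
box _ _ ≟ᶠ (_ ⇒ _) = no λ ()

atoms : Formula → List Formula
atoms (var n)   = var n ∷ []
atoms fls       = []
atoms (φ ⇒ ψ)   = atoms φ ++ atoms ψ
atoms (box i φ) = box i φ ∷ []

¬¬-decide-all : {P : Formula → Set} (l : List Formula) → ¬ ¬ All (Dec ∘ P) l
¬¬-decide-all []      = pure []
¬¬-decide-all (_ ∷ l) = ¬¬-excluded-middle >>= λ d → ¬¬-map (d ∷_) (¬¬-decide-all l)

module _ {P : Formula → Set} where

  assignment : ∀ {l} → All (Dec ∘ P) l → Formula → Bool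
  assignment []                 χ = false
  assignment {ψ ∷ _} (d ∷ ds) χ = if does (χ ≟ᶠ ψ) then does d else assignment ds χ

  assignment-reflects : ∀ {l} (ds : All (Dec ∘ P) l) →
                        All (λ χ → Reflects (P χ) (assignment ds χ)) l
  assignment-reflects []                 = []
  assignment-reflects {ψ ∷ _} (d ∷ ds) = at-head ∷ All.map at-tail (assignment-reflects ds)
    where
    at-head : Reflects (P ψ) (assignment (d ∷ ds) ψ)
    at-head with ψ ≟ᶠ ψ
    ... | yes _    = proof d
    ... | no ψ≢ψ = contradiction refl ψ≢ψ
    at-tail : ∀ {χ} → Reflects (P χ) (assignment ds χ) → Reflects (P χ) (assignment (d ∷ ds) χ)
    at-tail {χ} r with χ ≟ᶠ ψ
    ... | yes refl = proof d
    ... | no _     = r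

module _ (F : Frame) where
  open Frame F

  sat-stable : ∀ {val w} φ → Stable (sat F val w φ)
  sat-stable (var n)   = negated-stable
  sat-stable fls       = λ ¬¬⊥ → ¬¬⊥ id
  sat-stable (φ ⇒ ψ)   = λ ¬¬f s → sat-stable ψ (¬¬-map (λ f → f s) ¬¬f)
  sat-stable (box i φ) = λ ¬¬f w′ r → sat-stable φ (¬¬-map (λ f → f w′ r) ¬¬f)

  _[_]ᵛ : (ℕ → W → Set) → (ℕ → Formula) → ℕ → W → Set
  (val [ σ ]ᵛ) m w = sat F val w (σ m)

  sat-[] : ∀ val σ {w} φ → sat F val w (φ [ σ ]) ⇔ sat F (val [ σ ]ᵛ) w φ
  sat-[] val σ (var n)   = mk⇔ (λ s ¬s → ¬s s) (sat-stable (σ n))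
  sat-[] val σ fls       = mk⇔ id id
  sat-[] val σ (φ ⇒ ψ)   = mk⇔ (λ f → to IHψ ∘ f ∘ from IHφ) (λ f → from IHψ ∘ f ∘ to IHφ)
    where IHφ = sat-[] val σ φ
          IHψ = sat-[] val σ ψ
  sat-[] val σ (box i φ) = mk⇔ (λ f w′ r → to (sat-[] val σ φ) (f w′ r))
                               (λ f w′ r → from (sat-[] val σ φ) (f w′ r))

  beval-reflects : ∀ {val w} (a : Formula → Bool) φ →
                   All (λ ψ → Reflects (sat F val w ψ) (a ψ)) (atoms φ) →
                   Reflects (sat F val w φ) (beval a φ)
  beval-reflects a (var n)   (r ∷ []) = r
  beval-reflects a fls       []       = ofⁿ id
  beval-reflects a (φ ⇒ ψ)   rs       =
    beval-reflects a φ (++⁻ˡ (atoms φ) rs) →-reflects beval-reflects a ψ (++⁻ʳ (atoms φ) rs)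
  beval-reflects a (box i φ) (r ∷ []) = r

  -- An assignment reflecting sat on the atoms of φ exists only under ¬¬,
  -- which suffices as sat is ¬¬-stable.
  Tautology-valid : ∀ {φ} → Tautology φ → Valid F φ
  Tautology-valid {φ} tφ val w = sat-stable φ (¬¬-map holds (¬¬-decide-all (atoms φ)))
    where
    holds : All (Dec ∘ sat F val w) (atoms φ) → sat F val w φ
    holds ds = invert (subst (Reflects _) (tφ a) (beval-reflects a φ (assignment-reflects ds)))
      where a = assignment ds

  Deriv-sound : ∀ {Γ φ} → (∀ ψ → Γ ψ → Valid F ψ) → Deriv Γ φ → Valid F φ
  Deriv-sound ⊨Γ (ax γ)          = ⊨Γ _ γ
  Deriv-sound ⊨Γ (taut t)        = Tautology-valid t
  Deriv-sound ⊨Γ (kax i) val w □p⇒q □p w′ r = □p⇒q w′ r (□p w′ r)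
  Deriv-sound ⊨Γ (sub {φ} σ d) val w = from (sat-[] val σ φ) (Deriv-sound ⊨Γ d (val [ σ ]ᵛ) w)
  Deriv-sound ⊨Γ (mp d e) val w  = Deriv-sound ⊨Γ e val w (Deriv-sound ⊨Γ d val w)
  Deriv-sound ⊨Γ (nec i d) val w w′ _ = Deriv-sound ⊨Γ d val w′

record BisimilarCover (n : ℕ) (F G : Frame) (valG : ℕ → Frame.W G → Set) : Set₁ where
  field
    valF  : ℕ → Frame.W F → Set
    Z     : Frame.W F → Frame.W G → Set
    atom  : ∀ {p a g} → p < n → Z a g → valF p a ⇔ valG p g
    forth : ∀ i {a g a′} → Z a g → rel F i a a′ → ¬ ¬ (∃[ g′ ] rel G i g g′ × Z a′ g′)
    back  : ∀ i {a g g′} → Z a g → rel G i g g′ → ¬ ¬ (∃[ a′ ] rel F i a a′ × Z a′ g′)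
    onto  : ∀ g → ∃[ a ] Z a g

  sat-bisim : ∀ {φ a g} → VarsBelow n φ → Z a g → sat F valF a φ ⇔ sat G valG g φ
  sat-bisim (var p<n) z = mk⇔ (¬¬-map (to (atom p<n z))) (¬¬-map (from (atom p<n z)))
  sat-bisim fls       z = mk⇔ id id
  sat-bisim (imp vφ vψ) z = mk⇔ (λ f → to IHψ ∘ f ∘ from IHφ) (λ f → from IHψ ∘ f ∘ to IHφ)
    where IHφ = sat-bisim vφ z
          IHψ = sat-bisim vψ z
  sat-bisim {box i φ} (box vφ) z = mk⇔
    (λ f g′ r → sat-stable G φ (¬¬-map (λ (a′ , r′ , z′) → to (sat-bisim vφ z′) (f a′ r′)) (back i z r)))
    (λ f a′ r → sat-stable F φ (¬¬-map (λ (g′ , r′ , z′) → from (sat-bisim vφ z′) (f g′ r′)) (forth i z r)))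

Valid-cover : ∀ {n F G φ} → (∀ valG → ¬ ¬ BisimilarCover n F G valG) →
              VarsBelow n φ → Valid F φ → Valid G φ
Valid-cover {G = G} {φ} covers vφ ⊨φ valG g = sat-stable G φ (¬¬-map holds (covers valG))
  where
  holds : BisimilarCover _ _ G valG → sat G valG g φ
  holds B = to (sat-bisim vφ (proj₂ (onto g))) (⊨φ valF (proj₁ (onto g)))
    where open BisimilarCover B

infixr 6 _∧ᶠ_
infixr 5 _∨ᶠ_

_∧ᶠ_ : Formula → Formula → Formula
φ ∧ᶠ ψ = neg (φ ⇒ neg ψ)

_∨ᶠ_ : Formula → Formula → Formula
φ ∨ᶠ ψ = neg φ ⇒ ψ

⋀ : ∀ {k} → (Fin k → Formula) → Formula
⋀ {zero}  φ = neg fls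
⋀ {suc k} φ = φ zero ∧ᶠ ⋀ (φ ∘ suc)

⋁ : ∀ {k} → (Fin k → Formula) → Formula
⋁ {zero}  φ = fls
⋁ {suc k} φ = φ zero ∨ᶠ ⋁ (φ ∘ suc)

□ᵥ⁼ : Formula → Formula
□ᵥ⁼ φ = φ ∧ᶠ box v φ

◇ᵥ⁼ : Formula → Formula
◇ᵥ⁼ φ = φ ∨ᶠ dia v φ

module Connectives (F : Frame) (val : ℕ → Frame.W F → Set) where
  open Frame F

  infix 4 _⊨_
  _⊨_ : W → Formula → Set
  w ⊨ φ = sat F val w φ

  ∧-intro : ∀ {w} φ ψ → w ⊨ φ → w ⊨ ψ → w ⊨ (φ ∧ᶠ ψ)
  ∧-intro φ ψ s t f = f s t

  ∧-elim : ∀ {w} φ ψ → w ⊨ (φ ∧ᶠ ψ) → w ⊨ φ × w ⊨ ψ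
  ∧-elim φ ψ s = sat-stable F φ (λ ¬φ → s λ a _ → ¬φ a) , sat-stable F ψ (λ ¬ψ → s λ _ b → ¬ψ b)

  ⋀-intro : ∀ {k w} (φ : Fin k → Formula) → (∀ i → w ⊨ φ i) → w ⊨ ⋀ φ
  ⋀-intro {zero}  φ s = id
  ⋀-intro {suc k} φ s = ∧-intro (φ zero) (⋀ (φ ∘ suc)) (s zero) (⋀-intro (φ ∘ suc) (s ∘ suc))

  ⋀-elim : ∀ {k w} (φ : Fin k → Formula) → w ⊨ ⋀ φ → ∀ i → w ⊨ φ i
  ⋀-elim {suc k} φ s zero    = proj₁ (∧-elim (φ zero) (⋀ (φ ∘ suc)) s)
  ⋀-elim {suc k} φ s (suc i) = ⋀-elim (φ ∘ suc) (proj₂ (∧-elim (φ zero) (⋀ (φ ∘ suc)) s)) i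

  ⋁-intro : ∀ {k w} (φ : Fin k → Formula) i → w ⊨ φ i → w ⊨ ⋁ φ
  ⋁-intro {suc k} φ zero    s ¬s = contradiction s ¬s
  ⋁-intro {suc k} φ (suc i) s _  = ⋁-intro (φ ∘ suc) i s

  ⋁-elim : ∀ {k w} (φ : Fin k → Formula) → w ⊨ ⋁ φ → ¬ ¬ (∃[ i ] w ⊨ φ i)
  ⋁-elim {zero}  φ s = λ _ → s
  ⋁-elim {suc k} φ s ¬∃ = ⋁-elim (φ ∘ suc) (s λ s₀ → ¬∃ (zero , s₀)) λ (i , sᵢ) → ¬∃ (suc i , sᵢ)

  □ᵥ⁼-intro : ∀ {w} φ → w ⊨ φ → (∀ w′ → Rv w w′ → w′ ⊨ φ) → w ⊨ □ᵥ⁼ φ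
  □ᵥ⁼-intro φ = ∧-intro φ (box v φ)

  □ᵥ⁼-elim : ∀ {w} φ → w ⊨ □ᵥ⁼ φ → w ⊨ φ × (∀ w′ → Rv w w′ → w′ ⊨ φ)
  □ᵥ⁼-elim φ = ∧-elim φ (box v φ)

  ◇ᵥ⁼-here : ∀ {w} φ → w ⊨ φ → w ⊨ ◇ᵥ⁼ φ
  ◇ᵥ⁼-here φ s ¬s = contradiction s ¬s

  ◇ᵥ⁼-there : ∀ {w w′} φ → Rv w w′ → w′ ⊨ φ → w ⊨ ◇ᵥ⁼ φ
  ◇ᵥ⁼-there φ r s _ □¬φ = □¬φ _ r s

module ProductConnectives (U : Set) (R : U → U → Set) (V : Set) (S : V → V → Set)
                          (val : ℕ → U × V → Set) where
  open Connectives (product U R V S) val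

  □ᵥ⁼-at : ∀ {x y y′} φ → (x , y) ⊨ □ᵥ⁼ φ → ReflClosure S y y′ → (x , y′) ⊨ φ
  □ᵥ⁼-at φ s refl  = proj₁ (□ᵥ⁼-elim φ s)
  □ᵥ⁼-at φ s ⟪ r ⟫ = proj₂ (□ᵥ⁼-elim φ s) _ (r , refl)

  ◇ᵥ⁼-at : ∀ {x y} φ → (x , y) ⊨ ◇ᵥ⁼ φ → ¬ ¬ (∃[ y′ ] ReflClosure S y y′ × (x , y′) ⊨ φ)
  ◇ᵥ⁼-at φ s ¬∃ =
    s (λ here → ¬∃ (_ , refl , here)) λ { (_ , y′) (r , refl) there → ¬∃ (y′ , ⟪ r ⟫ , there) }

module _ {V : Set} {S : V → V → Set} (S-sym : Symmetric S) (S-pt : PseudoTransitive S) where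

  ReflClosure-clique : ∀ {y y₁ y₂} → ReflClosure S y y₁ → ReflClosure S y y₂ → y₁ ≢ y₂ → ¬ ¬ S y₁ y₂
  ReflClosure-clique refl    refl    y≢y = contradiction refl y≢y
  ReflClosure-clique refl    ⟪ r ⟫   _   = pure r
  ReflClosure-clique ⟪ r ⟫   refl    _   = pure (S-sym r)
  ReflClosure-clique ⟪ r₁ ⟫ ⟪ r₂ ⟫ y₁≢y₂ =
    ¬¬-map (λ { (inj₁ y₁≡y₂) → contradiction y₁≡y₂ y₁≢y₂ ; (inj₂ r) → r }) (S-pt (S-sym r₁) r₂)

module PigeonholeFormula (N : ℕ) where

  M : ℕ
  M = suc N

  A : Formula
  A = var 0

  P : Fin M → Formula
  P i = var (suc (toℕ i))

  Q : Fin N → Formula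
  Q j = var (suc (M + toℕ j))

  Excludes : Fin M → Formula
  Excludes i = ⋀ λ k → neg (P i ∧ᶠ P (punchIn i k))

  Persistent Columns Exclusive Coloured : Formula
  Persistent = □ᵥ⁼ (A ⇒ box h A)
  Columns    = ⋀ λ i → ◇ᵥ⁼ (A ∧ᶠ P i)
  Exclusive  = □ᵥ⁼ (⋀ Excludes)
  Coloured   = □ᵥ⁼ (A ⇒ ⋁ Q)

  Sparse : Fin N → Formula
  Sparse j = □ᵥ⁼ (Q j ⇒ box v (neg (Q j)))

  Ante Cons Φ : Formula
  Ante = Persistent ∧ᶠ Columns ∧ᶠ Exclusive
  Cons = Coloured ∧ᶠ ⋀ Sparse
  Φ    = Ante ⇒ box h (neg Cons)

  module _ {F : Frame} {val : ℕ → Frame.W F → Set} where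
    open Connectives F val

    Ante-intro : ∀ {w} → w ⊨ Persistent → w ⊨ Columns → w ⊨ Exclusive → w ⊨ Ante
    Ante-intro s₁ s₂ s₃ = ∧-intro Persistent (Columns ∧ᶠ Exclusive) s₁ (∧-intro Columns Exclusive s₂ s₃)

    Ante-elim : ∀ {w} → w ⊨ Ante → w ⊨ Persistent × w ⊨ Columns × w ⊨ Exclusive
    Ante-elim s = let (s₁ , s₂₃) = ∧-elim Persistent (Columns ∧ᶠ Exclusive) s
                  in s₁ , ∧-elim Columns Exclusive s₂₃

    Cons-intro : ∀ {w} → w ⊨ Coloured → (∀ j → w ⊨ Sparse j) → w ⊨ Cons
    Cons-intro s₁ s₂ = ∧-intro Coloured (⋀ Sparse) s₁ (⋀-intro Sparse s₂)

    Cons-elim : ∀ {w} → w ⊨ Cons → w ⊨ Coloured × (∀ j → w ⊨ Sparse j)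
    Cons-elim s = let (s₁ , s₂) = ∧-elim Coloured (⋀ Sparse) s in s₁ , ⋀-elim Sparse s₂

    Excludes-elim : ∀ {w i i′} → w ⊨ ⋀ Excludes → i ≢ i′ → w ⊨ P i → ¬ w ⊨ P i′
    Excludes-elim {w} {i} excl i≢i′ sᵢ sᵢ′ =
      ⋀-elim (λ k → neg (P i ∧ᶠ P (punchIn i k))) (⋀-elim Excludes excl i) (punchOut i≢i′)
             (∧-intro (P i) (P (punchIn i (punchOut i≢i′))) sᵢ
                      (subst (λ k → w ⊨ P k) (sym (punchIn-punchOut i≢i′)) sᵢ′))

  module Colouring {U : Set} {R : U → U → Set} {V : Set} {S : V → V → Set}
                   (S-sym : Symmetric S) (S-pt : PseudoTransitive S) (val : ℕ → U × V → Set)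
                   {x x′ y} (xRx′ : R x x′) (ante : sat (product U R V S) val (x , y) Ante)
                   (cons : sat (product U R V S) val (x′ , y) Cons) where
    open Connectives (product U R V S) val
    open ProductConnectives U R V S val

    persistent : (x , y) ⊨ Persistent
    persistent = proj₁ (Ante-elim ante)

    columns : (x , y) ⊨ Columns
    columns = proj₁ (proj₂ (Ante-elim ante))

    exclusive : (x , y) ⊨ Exclusive
    exclusive = proj₂ (proj₂ (Ante-elim ante))

    coloured : (x′ , y) ⊨ Coloured
    coloured = proj₁ (Cons-elim cons)

    sparse : ∀ j → (x′ , y) ⊨ Sparse j
    sparse = proj₂ (Cons-elim cons)

    Witness : Fin M → Set
    Witness i = ∃[ y′ ] ReflClosure S y y′ × (x , y′) ⊨ A ∧ᶠ P i

    witnesses : ¬ ¬ (∀ i → Witness i)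
    witnesses = ¬¬-∀-Fin λ i → ◇ᵥ⁼-at (A ∧ᶠ P i) (⋀-elim (λ i → ◇ᵥ⁼ (A ∧ᶠ P i)) columns i)

    module _ (wit : ∀ i → Witness i) where

      Y : Fin M → V
      Y i = proj₁ (wit i)

      y⟶Y : ∀ i → ReflClosure S y (Y i)
      y⟶Y i = proj₁ (proj₂ (wit i))

      A∧P-at-Y : ∀ i → (x , Y i) ⊨ A × (x , Y i) ⊨ P i
      A∧P-at-Y i = ∧-elim A (P i) (proj₂ (proj₂ (wit i)))

      Y-injective : ∀ {i i′} → i ≢ i′ → Y i ≢ Y i′
      Y-injective {i} {i′} i≢i′ Yi≡Yi′ =
        Excludes-elim (□ᵥ⁼-at (⋀ Excludes) exclusive (y⟶Y i)) i≢i′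
          (proj₂ (A∧P-at-Y i)) (subst (λ y′ → (x , y′) ⊨ P i′) (sym Yi≡Yi′) (proj₂ (A∧P-at-Y i′)))

      colours : ¬ ¬ (∀ i → ∃[ j ] (x′ , Y i) ⊨ Q j)
      colours = ¬¬-∀-Fin λ i → ⋁-elim Q (□ᵥ⁼-at (A ⇒ ⋁ Q) coloured (y⟶Y i) (A-at-x′ i))
        where
        A-at-x′ : ∀ i → (x′ , Y i) ⊨ A
        A-at-x′ i = □ᵥ⁼-at (A ⇒ box h A) persistent (y⟶Y i) (proj₁ (A∧P-at-Y i)) (x′ , Y i) (xRx′ , refl)

      no-sparse-colouring : ¬ (∀ i → ∃[ j ] (x′ , Y i) ⊨ Q j)
      no-sparse-colouring col with pigeonhole (n<1+n N) (proj₁ ∘ col)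
      ... | i , i′ , i<i′ , same =
        ReflClosure-clique S-sym S-pt (y⟶Y i) (y⟶Y i′) (Y-injective (<⇒≢ i<i′))
          λ r → □¬Q (x′ , Y i′) (r , refl) Q-at-i′
        where
        j = proj₁ (col i)
        □¬Q : (x′ , Y i) ⊨ box v (neg (Q j))
        □¬Q = □ᵥ⁼-at (Q j ⇒ box v (neg (Q j))) (sparse j) (y⟶Y i) (proj₂ (col i))
        Q-at-i′ : (x′ , Y i′) ⊨ Q j
        Q-at-i′ = subst (λ j′ → (x′ , Y i′) ⊨ Q j′) (sym same) (proj₂ (col i′))

  Φ-valid : KxDiff Φ
  Φ-valid U R V S S-sym S-pt val (x , y) ante (x′ , _) (xRx′ , refl) cons =
    witnesses λ wit → colours wit (no-sparse-colouring wit)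
    where open Colouring S-sym S-pt val xRx′ ante cons

module RefutingFrame (N : ℕ) (V : Set) (er : Fin (suc N) → V) where
  open PigeonholeFormula N

  Special : V → Set
  Special y = ∃[ i ] y ≡ er i

  size : Bool → ℕ
  size true  = M
  size false = N

  Layer : Bool → Set
  Layer b = Fin (size b)

  -- inner true i and inner false j form the upper and lower cliques; outer y b, for b = true, false,
  -- are two copies of the non-special points of V.
  data World : Set where
    outer : (y : V) → .(¬ Special y) → Bool → World
    inner : (b : Bool) → Layer b → World

  Rʰ : World → World → Set
  Rʰ (outer y _ _) (outer y′ _ _) = y ≡ y′
  Rʰ (inner _ _)   (inner _ _)    = ⊤
  Rʰ (outer _ _ _) (inner _ _)    = ⊥
  Rʰ (inner _ _)   (outer _ _ _)  = ⊥

  Rᵛ : World → World → Set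
  Rᵛ (outer y _ b) (outer y′ _ b′) = y ≢ y′ × b ≡ b′
  Rᵛ (outer _ _ b) (inner b′ _)    = b ≡ b′
  Rᵛ (inner b _)   (outer _ _ b′)  = b ≡ b′
  Rᵛ (inner b j)   (inner b′ j′)   = Σ (b ≡ b′) λ { refl → j ≢ j′ }

  G : Frame
  G = record { W = World ; Rh = Rʰ ; Rv = Rᵛ }

  refuting-val : ℕ → World → Set
  refuting-val _       (outer _ _ _)   = ⊥
  refuting-val zero    (inner _ _)     = ⊤
  refuting-val (suc m) (inner true i)  = toℕ i ≡ m
  refuting-val (suc m) (inner false j) = M + toℕ j ≡ m

  open Connectives G refuting-val

  M+j≢i : ∀ (i : Fin M) (j : Fin N) → M + toℕ j ≢ toℕ i
  M+j≢i i j e = m+n≮m M (toℕ j) (subst (_< M) (sym e) (toℕ<n i))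

  A⇒□ʰA : ∀ g → g ⊨ A ⇒ box h A
  A⇒□ʰA (outer _ _ _) a                 = ⊥-elim (a id)
  A⇒□ʰA (inner _ _)   _ (inner _ _) _ ¬⊤ = ¬⊤ tt

  excludes : ∀ g → g ⊨ ⋀ Excludes
  excludes g = ⋀-intro Excludes λ i → ⋀-intro (λ k → neg (P i ∧ᶠ P (punchIn i k))) λ k s →
    let (Pᵢ , Pₖ) = ∧-elim (P i) (P (punchIn i k)) s in not-both g Pᵢ Pₖ
    where
    not-both : ∀ g {i k} → g ⊨ P i → ¬ g ⊨ P (punchIn i k)
    not-both (outer _ _ _)   Pᵢ _  = Pᵢ id
    not-both (inner true j)  Pᵢ Pₖ = Pᵢ λ j≡i → Pₖ λ j≡k →
      punchInᵢ≢i _ _ (toℕ-injective (trans (sym j≡k) j≡i))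
    not-both (inner false j) Pᵢ _  = Pᵢ (M+j≢i _ j)

  upper-Columns : inner true zero ⊨ Columns
  upper-Columns = ⋀-intro (λ i → ◇ᵥ⁼ (A ∧ᶠ P i)) λ
    { zero    → ◇ᵥ⁼-here (A ∧ᶠ P zero) (A∧P zero)
    ; (suc i) → ◇ᵥ⁼-there (A ∧ᶠ P (suc i)) (refl , λ ()) (A∧P (suc i)) }
    where
    A∧P : ∀ i → inner true i ⊨ A ∧ᶠ P i
    A∧P i = ∧-intro {inner true i} A (P i) (λ ¬⊤ → ¬⊤ tt) (λ ¬≡ → ¬≡ refl)

  Ante-at-upper : inner true zero ⊨ Ante
  Ante-at-upper = Ante-intro
    (□ᵥ⁼-intro (A ⇒ box h A) (A⇒□ʰA _) (λ g _ → A⇒□ʰA g))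
    upper-Columns
    (□ᵥ⁼-intro (⋀ Excludes) (excludes _) (λ g _ → excludes g))

  Q-isolated : ∀ j g → g ⊨ Q j ⇒ box v (neg (Q j))
  Q-isolated j (outer _ _ _)    Qⱼ = ⊥-elim (Qⱼ id)
  Q-isolated j (inner true i)   Qⱼ = ⊥-elim (Qⱼ λ i≡M+j → M+j≢i i j (sym i≡M+j))
  Q-isolated j (inner false j′) Qⱼ (outer _ _ _)    _            Qⱼ′ = Qⱼ′ id
  Q-isolated j (inner false j′) Qⱼ (inner false j″) (refl , j′≢j″) Qⱼ′ =
    Qⱼ λ j′≡j → Qⱼ′ λ j″≡j → j′≢j″ (toℕ-injective (+-cancelˡ-≡ M _ _ (trans j′≡j (sym j″≡j))))

  Cons-at-lower : ∀ j → inner false j ⊨ Cons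
  Cons-at-lower j = Cons-intro
    (□ᵥ⁼-intro (A ⇒ ⋁ Q) (λ _ → Q-at j) A⇒⋁Q)
    (λ j′ → □ᵥ⁼-intro (Q j′ ⇒ box v (neg (Q j′))) (Q-isolated j′ _) (λ g _ → Q-isolated j′ g))
    where
    Q-at : ∀ j → inner false j ⊨ ⋁ Q
    Q-at j = ⋁-intro Q j λ ¬≡ → ¬≡ refl
    A⇒⋁Q : ∀ g → Rᵛ (inner false j) g → g ⊨ A ⇒ ⋁ Q
    A⇒⋁Q (outer _ _ _)    _       a = ⊥-elim (a id)
    A⇒⋁Q (inner true _)   (() , _)
    A⇒⋁Q (inner false j′) _       _ = Q-at j′

  Φ-fails : Fin N → ¬ inner true zero ⊨ Φ
  Φ-fails j ⊨Φ = ⊨Φ Ante-at-upper (inner false j) tt (Cons-at-lower j)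

transpose-hit : ∀ {m} (i j : Fin m) → PC.transpose i j i ≡ j
transpose-hit i j rewrite dec-true (i ≟ i) refl = refl

transpose-injective : ∀ {m} (s t : Fin m) {i i′} → PC.transpose s t i ≡ PC.transpose s t i′ → i ≡ i′
transpose-injective s t {i} {i′} eq = begin
  i                                      ≡⟨ PC.transpose-inverse t s ⟨
  PC.transpose t s (PC.transpose s t i)  ≡⟨ cong (PC.transpose t s) eq ⟩
  PC.transpose t s (PC.transpose s t i′) ≡⟨ PC.transpose-inverse t s ⟩
  i′                                     ∎
  where open ≡-Reasoning

collapse : ∀ {k} → Fin k → Fin (suc k) → Fin k
collapse d zero    = d
collapse d (suc j) = j

collapse-collision : ∀ {k} (d : Fin k) {i i′} → i ≢ i′ → collapse d i ≡ collapse d i′ → collapse d i ≡ d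
collapse-collision d {zero}  {_}      _    _  = refl
collapse-collision d {suc i} {zero}   _    eq = eq
collapse-collision d {suc i} {suc i′} i≢i′ eq = contradiction (cong suc eq) i≢i′

-- If π : Fin m → Fin k has a section and every collision of π is resolved by a ∼-twin, then
-- the relation π i ∼ j is a bisimulation between the difference frames (Fin m, ≢) and (Fin k, ≢).
module DifferenceCover {m k} (_∼_ : Fin k → Fin k → Set) (∼-refl : Reflexive _∼_) (∼-sym : Symmetric _∼_)
                       (π : Fin m → Fin k) (σ : Fin k → Fin m) (π∘σ : ∀ j → π (σ j) ≡ j)
                       (twin : ∀ {i i′} → i ≢ i′ → π i ≡ π i′ → ∃[ j ] j ≢ π i × π i ∼ j) where

  ≡⇒∼ : ∀ {j j′} → j ≡ j′ → j ∼ j′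
  ≡⇒∼ refl = ∼-refl

  cover-forth : ∀ {i i′ j} → i ≢ i′ → π i ∼ j → ∃[ j′ ] j ≢ j′ × π i′ ∼ j′
  cover-forth {i} {i′} {j} i≢i′ πi∼j with j ≟ π i′
  ... | no j≢πi′ = π i′ , j≢πi′ , ∼-refl
  ... | yes refl with π i ≟ π i′
  ...   | no πi≢πi′ = π i , πi≢πi′ ∘ sym , ∼-sym πi∼j
  ...   | yes πi≡πi′ with twin i≢i′ πi≡πi′
  ...     | j′ , j′≢πi , πi∼j′ =
    j′ , (λ πi′≡j′ → j′≢πi (trans (sym πi′≡j′) (sym πi≡πi′))) , subst (_∼ j′) πi≡πi′ πi∼j′

  cover-back : ∀ {i j j′} → π i ∼ j → j ≢ j′ → ∃[ i′ ] i ≢ i′ × π i′ ∼ j′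
  cover-back {i} {j} {j′} πi∼j j≢j′ with σ j′ ≟ i
  ... | no σj′≢i = σ j′ , σj′≢i ∘ sym , ≡⇒∼ (π∘σ j′)
  ... | yes refl = σ j , σj′≢σj , subst (_∼ j′) (sym (π∘σ j)) (∼-sym (subst (_∼ j) (π∘σ j′) πi∼j))
    where
    σj′≢σj : σ j′ ≢ σ j
    σj′≢σj e = j≢j′ (trans (sym (π∘σ j)) (trans (cong π (sym e)) (π∘σ j′)))

bit : ∀ {A : Set} → Dec A → Fin 2
bit (yes _) = suc zero
bit (no _)  = zero

bit-≡⇒ : ∀ {A B : Set} (a? : Dec A) (b? : Dec B) → bit a? ≡ bit b? → A → B
bit-≡⇒ _        (yes b) _  _ = b
bit-≡⇒ (no ¬a)  (no _)  _  a = contradiction a ¬a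
bit-≡⇒ (yes _)  (no _)  ()

¬¬-twins : ∀ {n k} → 2 ^ n < k → (X : Fin k → ℕ → Set) →
           ¬ ¬ (∃₂ λ a b → a ≢ b × (∀ {p} → p < n → X a p ⇔ X b p))
¬¬-twins {n} 2ⁿ<k X = ¬¬-map twins (¬¬-∀-Fin λ a → ¬¬-∀-Fin λ p → ¬¬-excluded-middle)
  where
  twins : (∀ a (p : Fin n) → Dec (X a (toℕ p))) → ∃₂ λ a b → a ≢ b × (∀ {p} → p < n → X a p ⇔ X b p)
  twins X? with pigeonhole 2ⁿ<k (λ a → funToFin (bit ∘ X? a))
  ... | a , b , a<b , same =
    a , b , <⇒≢ a<b , λ p<n → subst (λ q → X a q ⇔ X b q) (toℕ-fromℕ< p<n) (agree (fromℕ< p<n))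
    where
    bits : ∀ p → bit (X? a p) ≡ bit (X? b p)
    bits p = begin
      bit (X? a p)                       ≡⟨ finToFun-funToFin (bit ∘ X? a) p ⟨
      finToFun (funToFin (bit ∘ X? a)) p ≡⟨ cong (λ c → finToFun c p) same ⟩
      finToFun (funToFin (bit ∘ X? b)) p ≡⟨ finToFun-funToFin (bit ∘ X? b) p ⟩
      bit (X? b p)                       ∎
      where open ≡-Reasoning
    agree : ∀ p → X a (toℕ p) ⇔ X b (toℕ p)
    agree p = mk⇔ (bit-≡⇒ (X? a p) (X? b p) (bits p)) (bit-≡⇒ (X? b p) (X? a p) (sym (bits p)))

module Encoding {m : ℕ} {U V : Set} (e : Fin (m * m) ↣ V) (ι : (V ⊎ V) ↣ U) where
  open Injection

  pair : Fin m × Fin m → V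
  pair (s , t) = to e (combine s t)

  pair-injective : Injective _≡_ _≡_ pair
  pair-injective {s , t} {s′ , t′} eq with combine-injective s t s′ t′ (injective e eq)
  ... | refl , refl = refl

  tag : Bool → V → V ⊎ V
  tag true  = inj₁
  tag false = inj₂

  tag-injective : ∀ {b b′ y y′} → tag b y ≡ tag b′ y′ → b ≡ b′ × y ≡ y′
  tag-injective {true}  {true}  refl = refl , refl
  tag-injective {false} {false} refl = refl , refl

  code : Bool × Fin m × Fin m → U
  code (b , st) = to ι (tag b (pair st))

  code-injective : Injective _≡_ _≡_ code
  code-injective eq with tag-injective (injective ι eq)
  ... | refl , eq′ with pair-injective eq′
  ...   | refl = refl

module Transfer (n N : ℕ) {U V : Set} (e : Fin (suc N * suc N) ↣ V) (ι : (V ⊎ V) ↣ U) where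
  open PigeonholeFormula N using (M)
  open Encoding {M} e ι using (pair; pair-injective; code; code-injective)

  er : Fin M → V
  er i = pair (i , zero)

  er-injective : Injective _≡_ _≡_ er
  er-injective eq = cong proj₁ (pair-injective eq)

  open RefutingFrame N V er public

  F : Frame
  F = product U (univ U) V (neq V)

  Code : Set
  Code = Bool × Fin M × Fin M

  -- Points of U outside the image of code behave as if coded by (true , 0 , 0).
  Coded : U → Code → Set
  Coded x c = x ≡ code c ⊎ ((∀ c′ → x ≢ code c′) × c ≡ (true , zero , zero))

  Coded-functional : ∀ {x c c′} → Coded x c → Coded x c′ → c ≡ c′
  Coded-functional (inj₁ x≡c)       (inj₁ x≡c′)       = code-injective (trans (sym x≡c) x≡c′)
  Coded-functional {c = c}       (inj₁ x≡c)  (inj₂ (x∉ , _)) = contradiction x≡c (x∉ c)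
  Coded-functional {c′ = c′} (inj₂ (x∉ , _)) (inj₁ x≡c′) = contradiction x≡c′ (x∉ c′)
  Coded-functional (inj₂ (_ , c≡₀)) (inj₂ (_ , c′≡₀)) = trans c≡₀ (sym c′≡₀)

  ¬¬-Coded : ∀ x → ¬ ¬ ∃ (Coded x)
  ¬¬-Coded x = ¬¬-map decode ¬¬-excluded-middle
    where
    decode : Dec (∃ λ c → x ≡ code c) → ∃ (Coded x)
    decode (yes (c , x≡c)) = c , inj₁ x≡c
    decode (no x∉)         = (true , zero , zero) , inj₂ ((λ c x≡c → x∉ (c , x≡c)) , refl)

  collapseᵇ : ∀ {d : Fin N} b → Fin M → Layer b
  collapseᵇ     true  = id
  collapseᵇ {d} false = collapse d

  embed : ∀ b → Layer b → Fin M
  embed true  = id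
  embed false = suc

  collapse-embed : ∀ {d} b j → collapseᵇ {d} b (embed b j) ≡ j
  collapse-embed true  j = refl
  collapse-embed false j = refl

  module Cover (val : ℕ → World → Set) {da db : Fin N} (da≢db : da ≢ db)
               (twins : ∀ {p} → p < n → val p (inner false da) ⇔ val p (inner false db)) where

    _≈_ : World → World → Set
    g ≈ g′ = ∀ {p} → p < n → val p g ⇔ val p g′

    ≈-refl : ∀ {g} → g ≈ g
    ≈-refl _ = ⇔-refl

    ≈-sym : ∀ {g g′} → g ≈ g′ → g′ ≈ g
    ≈-sym g≈g′ p<n = ⇔-sym (g≈g′ p<n)

    ≡⇒≈ : ∀ {b j j′} → j ≡ j′ → inner b j ≈ inner b j′
    ≡⇒≈ refl = ≈-refl

    π : ∀ b → Fin M × Fin M → Fin M → Layer b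
    π b (s , t) = collapseᵇ {da} b ∘ PC.transpose s t

    σ : ∀ b → Fin M × Fin M → Layer b → Fin M
    σ b (s , t) = PC.transpose t s ∘ embed b

    π∘σ : ∀ b st j → π b st (σ b st j) ≡ j
    π∘σ b (s , t) j = trans (cong (collapseᵇ b) (PC.transpose-inverse s t)) (collapse-embed b j)

    π-hit : ∀ b i j → π b (i , embed b j) i ≡ j
    π-hit b i j = trans (cong (collapseᵇ b) (transpose-hit i (embed b j))) (collapse-embed b j)

    twin : ∀ b st {i i′} → i ≢ i′ → π b st i ≡ π b st i′ →
           ∃[ j ] j ≢ π b st i × inner b (π b st i) ≈ inner b j
    twin true  (s , t) i≢i′ eq = contradiction (transpose-injective s t eq) i≢i′
    twin false (s , t) i≢i′ eq = db , (λ db≡πi → da≢db (trans (sym πi≡da) (sym db≡πi))) ,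
                                 subst (λ d → inner false d ≈ inner false db) (sym πi≡da) twins
      where
      πi≡da = collapse-collision da (i≢i′ ∘ transpose-injective s t) eq

    module LayerCover (b : Bool) (st : Fin M × Fin M) =
      DifferenceCover (λ j j′ → inner b j ≈ inner b j′) ≈-refl ≈-sym
                      (π b st) (σ b st) (π∘σ b st) (twin b st)

    HoldsAtImage : ℕ → Code → V → Set
    HoldsAtImage p (b , st) y = (∃[ i ] y ≡ er i × val p (inner b (π b st i)))
                       ⊎ (Σ (¬ Special y) λ y∉ → val p (outer y y∉ b))

    valF : ℕ → U × V → Set
    valF p (x , y) = ∃[ c ] Coded x c × HoldsAtImage p c y

    -- (x , er i) corresponds to the point π b st i of layer b, where (b , st) is the code of x,
    -- up to agreement on the first n variables; a non-special (x , y) corresponds to outer y b.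
    Z : U × V → World → Set
    Z (x , y) (outer y′ _ b) = y ≡ y′ × ∃[ st ] Coded x (b , st)
    Z (x , y) (inner b j)    = ∃[ st ] ∃[ i ] Coded x (b , st) × y ≡ er i × inner b (π b st i) ≈ inner b j

    valF→outer : ∀ {p x y b st} .(y∉ : ¬ Special y) → Coded x (b , st) →
                 valF p (x , y) → val p (outer y y∉ b)
    valF→outer y∉ coded (_ , coded′ , holds) with Coded-functional coded′ coded | holds
    ... | refl | inj₁ (i , y≡i , _) = ⊥-elim-irr (y∉ (i , y≡i))
    ... | refl | inj₂ (_ , holds-p) = holds-p

    valF→inner : ∀ {p x y b st i} → Coded x (b , st) → y ≡ er i →
                 valF p (x , y) → val p (inner b (π b st i))
    valF→inner {i = i} coded y≡i (_ , coded′ , holds) with Coded-functional coded′ coded | holds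
    ... | refl | inj₂ (y∉ , _)         = contradiction (i , y≡i) y∉
    ... | refl | inj₁ (i′ , y≡i′ , holds-p) with er-injective {i′} {i} (trans (sym y≡i′) y≡i)
    ...   | refl = holds-p

    atom : ∀ {p a g} → p < n → Z a g → valF p a ⇔ val p g
    atom {g = outer _ y∉ b} p<n (refl , st , coded) =
      mk⇔ (valF→outer y∉ coded) (λ holds-p → (b , st) , coded , inj₂ ((λ s → ⊥-elim-irr (y∉ s)) , holds-p))
    atom {g = inner b j}    p<n (st , i , coded , y≡i , πi≈j) =
      mk⇔ (to (πi≈j p<n) ∘ valF→inner {i = i} coded y≡i)
          (λ holds-p → (b , st) , coded , inj₁ (i , y≡i , from (πi≈j p<n) holds-p))

    forthʰ : ∀ {a g a′} → Z a g → Frame.Rh F a a′ → ¬ ¬ (∃[ g′ ] Rʰ g g′ × Z a′ g′)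
    forthʰ {x , y} {g} {x′ , _} z (_ , refl) = ¬¬-map (λ (c′ , coded′) → step g z c′ coded′) (¬¬-Coded x′)
      where
      step : ∀ g → Z (x , y) g → ∀ c′ → Coded x′ c′ → ∃[ g′ ] Rʰ g g′ × Z (x′ , y) g′
      step (outer _ y∉ _) (refl , _)            (b′ , st′) coded′ =
        outer y y∉ b′ , refl , refl , st′ , coded′
      step (inner _ _)    (_ , i , _ , y≡i , _) (b′ , st′) coded′ =
        inner b′ (π b′ st′ i) , tt , st′ , i , coded′ , y≡i , ≈-refl

    backʰ : ∀ {a g g′} → Z a g → Rʰ g g′ → ¬ ¬ (∃[ a′ ] Frame.Rh F a a′ × Z a′ g′)
    backʰ {x , y} {outer _ _ _} {outer _ _ b′} (refl , _) refl ¬∃ =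
      ¬∃ ((code (b′ , zero , zero) , y) , (tt , refl) , refl , (zero , zero) , inj₁ refl)
    backʰ {x , y} {inner _ _}   {inner b′ j′} (_ , i , _ , y≡i , _) _ ¬∃ =
      ¬∃ ((code (b′ , i , embed b′ j′) , y) , (tt , refl) ,
          (i , embed b′ j′) , i , inj₁ refl , y≡i , ≡⇒≈ (π-hit b′ i j′))

    forthᵛ : ∀ {a g a′} → Z a g → Frame.Rv F a a′ → ¬ ¬ (∃[ g′ ] Rᵛ g g′ × Z a′ g′)
    forthᵛ {x , y} {g} {_ , y′} z (y≢y′ , refl) = ¬¬-map (step g z) ¬¬-excluded-middle
      where
      step : ∀ g → Z (x , y) g → Dec (Special y′) → ∃[ g′ ] Rᵛ g g′ × Z (x , y′) g′
      step (outer _ _ b) (refl , st , coded) (yes (i′ , y′≡i′)) =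
        inner b (π b st i′) , refl , st , i′ , coded , y′≡i′ , ≈-refl
      step (outer _ _ b) (refl , st , coded) (no y′∉) = outer y′ y′∉ b , (y≢y′ , refl) , refl , st , coded
      step (inner b j) (st , i , coded , y≡i , πi≈j) (yes (i′ , y′≡i′)) =
        let (j′ , j≢j′ , πi′≈j′) = LayerCover.cover-forth b st i≢i′ πi≈j
        in inner b j′ , (refl , j≢j′) , st , i′ , coded , y′≡i′ , πi′≈j′
        where
        i≢i′ : i ≢ i′
        i≢i′ i≡i′ = y≢y′ (trans y≡i (trans (cong er i≡i′) (sym y′≡i′)))
      step (inner b j) (st , _ , coded , _) (no y′∉) = outer y′ y′∉ b , refl , refl , st , coded

    backᵛ : ∀ {a g g′} → Z a g → Rᵛ g g′ → ¬ ¬ (∃[ a′ ] Frame.Rv F a a′ × Z a′ g′)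
    backᵛ {x , y} {g} {g′} z r ¬∃ = ¬∃ (step g g′ z r)
      where
      step : ∀ g g′ → Z (x , y) g → Rᵛ g g′ → ∃[ a′ ] Frame.Rv F (x , y) a′ × Z a′ g′
      step (outer _ _ _) (outer y′ _ _) (refl , st , coded) (y≢y′ , refl) =
        (x , y′) , (y≢y′ , refl) , refl , st , coded
      step (outer _ y∉ _) (inner b j′) (refl , st , coded) refl =
        (x , er i′) , ((λ y≡i′ → ⊥-elim-irr (y∉ (i′ , y≡i′))) , refl) ,
        st , i′ , coded , refl , ≡⇒≈ (π∘σ b st j′)
        where i′ = σ b st j′
      step (inner _ _) (outer y′ y′∉ _) (st , i , coded , y≡i , _) refl =
        (x , y′) , ((λ y≡y′ → ⊥-elim-irr (y′∉ (i , trans (sym y≡y′) y≡i))) , refl) , refl , st , coded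
      step (inner b j) (inner _ j′) (st , i , coded , y≡i , πi≈j) (refl , j≢j′) =
        let (i′ , i≢i′ , πi′≈j′) = LayerCover.cover-back b st πi≈j j≢j′
        in (x , er i′) , ((λ y≡i′ → i≢i′ (er-injective {i} {i′} (trans (sym y≡i) y≡i′))) , refl) ,
           st , i′ , coded , refl , πi′≈j′

    onto : ∀ g → ∃[ a ] Z a g
    onto (outer y _ b) = (code (b , zero , zero) , y) , refl , (zero , zero) , inj₁ refl
    onto (inner b j)   = (code (b , zero , embed b j) , er zero) ,
                         (zero , embed b j) , zero , inj₁ refl , refl , ≡⇒≈ (π-hit b zero j)

    cover : BisimilarCover n F G val
    cover = record
      { valF = valF ; Z = Z ; atom = atom
      ; forth = λ { h → forthʰ ; v → forthᵛ }
      ; back  = λ { h → backʰ ; v → backᵛ }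
      ; onto  = onto
      }

  covers : 2 ^ n < N → ∀ val → ¬ ¬ BisimilarCover n F G val
  covers 2ⁿ<N val = ¬¬-map (λ (_ , _ , da≢db , twins) → Cover.cover val da≢db twins)
                           (¬¬-twins 2ⁿ<N λ j p → val p (inner false j))

module _ (n : ℕ) {U V : Set} where
  open PigeonholeFormula (suc (2 ^ n)) using (M; Φ)

  Φ-underivable : (e : Fin (M * M) ↣ V) (ι : (V ⊎ V) ↣ U) {Γ : Formula → Set₁} →
                  (∀ ψ → Γ ψ → VarsBelow n ψ) → (∀ ψ → Γ ψ → Valid (product U (univ U) V (neq V)) ψ) →
                  ¬ Deriv Γ Φ
  Φ-underivable e ι {Γ} Γ-vars ⊨Γ ⊢Φ =
    Φ-fails zero (Deriv-sound G ⊨Γ-in-G ⊢Φ refuting-val (inner true zero))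
    where
    open Transfer n (suc (2 ^ n)) e ι
    ⊨Γ-in-G : ∀ ψ → Γ ψ → Valid G ψ
    ⊨Γ-in-G ψ γ = Valid-cover (covers (n<1+n _)) (Γ-vars ψ γ) (⊨Γ ψ γ)

theorem5p1 : (L : Formula → Set₁)
    → IsNormal L
    → (∀ φ → KxDiff φ → L φ)
    → (∀ (k : ℕ) → 1 ≤ k →
         Σ[ U ∈ Set ] Σ[ V ∈ Set ]
           ((Fin k ↣ V) × ((V ⊎ V) ↣ U)
             × FrameFor L (product U (univ U) V (neq V))))
    → ¬ (Σ[ Γ ∈ (Formula → Set₁) ]
           (FinitelyManyVars Γ × (∀ φ → L φ ⇔ Deriv Γ φ)))
theorem5p1 L _ K×Diff⊆L frames (Γ , (n , Γ-vars) , L⇔Γ) =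
  let (U , V , e , ι , ⊨L) = frames _ (s≤s z≤n)
  in Φ-underivable n e ι Γ-vars (λ ψ γ → ⊨L ψ (from (L⇔Γ ψ) (ax γ))) (to (L⇔Γ Φ) (K×Diff⊆L Φ Φ-valid))
  where open PigeonholeFormula (suc (2 ^ n)) using (Φ; Φ-valid)
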